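{- There exists $\alpha_0>0$ such that for every $\alpha\in(0,\alpha_0]$ there is $\varepsilon_0>0$ such that for every $\varepsilon\in(0,\varepsilon_0]$ there is $\tau_0>0$ such that for every $\tau\in(0,\tau_0]$ there is $\gamma_0>0$ such that for every $\gamma\in(0,\gamma_0]$ there is $n_0$ such that the following holds for all $n\ge n_0$ and $k\in\mathbb{N}$. Let $G$ be a $d$-regular digraph on $n$ vertices with $d\geq (\alpha+\varepsilon) n$. If $\mathcal{P}_k=\{V_{ij}:i,j\in [k]\}$ is a $(k^2,\tau,\gamma)$-partition of $G$, then $|V_{i*}|,|V_{*i}|\geq d-\varepsilon n/2$ for all $i \in [k]$. In particular, $\mathcal{P}_k$ is a $(k^2,\alpha+\varepsilon/2,\gamma)$-partition of $G$.
   Context: A digraph is a finite directed graph without loops, with at most one edge from $a$ to $b$ for each ordered pair of distinct vertices; it is $d$-regular if every vertex has exactly $d$ outneighbours and $d$ inneighbours. A $k^2$-partition of $V(G)$ is a partition $\{V_{ij}:i,j\in[k]\}$ of $V(G)$ (parts may be empty); write $V_{i*}=\bigcup_{j}V_{ij}$, $V_{*j}=\bigcup_i V_{ij}$. $E(A,B)$ is the set of edges $ab$ with $a\in A$, $b\in B$. The bad edges are $\mathcal{B}_k(\mathcal{P}_k,G)=\bigcup_{i\neq j}E(V_{i*},V_{*j})$. A $(k^2,\tau,\gamma)$-partition is a $k^2$-partition with $|\mathcal{B}_k(\mathcal{P}_k,G)|\leq \gamma n^2$ and $|V_{i*}|,|V_{*j}|\geq \tau n$ for all $i,j\in[k]$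.
   Formalization: The parameters α, ε, τ and γ range only over the rationals, and the thresholds α₀, ε₀, τ₀ and γ₀ are taken in ℚ as well. -}

module Defs where

open import Data.Nat using (ℕ; zero; suc; _+_)
open import Data.Fin using (Fin; zero; suc)
open import Data.Fin.Properties using (_≟_)
open import Data.Bool using (Bool; true; false; _∧_; not)
open import Data.Product using (_×_; _,_; proj₁; proj₂)
open import Data.Integer using (+_)
open import Data.Rational using (ℚ; _/_; _≤_; _*_)
open import Relation.Nullary.Decidable using (⌊_⌋)
open import Relation.Binary.PropositionalEquality using (_≡_)

toℚ : ℕ → ℚ
toℚ n = + n / 1

count : {n : ℕ} → (Fin n → Bool) → ℕ
count {zero} P = 0
count {suc n} P with P zero
... | true  = suc (count (λ v → P (suc v)))
... | false = count (λ v → P (suc v))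

sumFin : {n : ℕ} → (Fin n → ℕ) → ℕ
sumFin {zero} f = 0
sumFin {suc n} f = f zero + sumFin (λ v → f (suc v))

record Digraph (n : ℕ) : Set where
  field
    adj    : Fin n → Fin n → Bool
    noLoop : (v : Fin n) → adj v v ≡ false
open Digraph public

outdeg : {n : ℕ} → Digraph n → Fin n → ℕ
outdeg G a = count (λ b → adj G a b)

indeg : {n : ℕ} → Digraph n → Fin n → ℕ
indeg G b = count (λ a → adj G a b)

Regular : {n : ℕ} → Digraph n → ℕ → Set
Regular {n} G d = (v : Fin n) → (outdeg G v ≡ d) × (indeg G v ≡ d)

-- A k²-partition {V_ij : i,j ∈ [k]} of Fin n: each vertex is assigned the
-- index (i , j) of the part containing it (parts may be empty).
Partition : ℕ → ℕ → Set
Partition n k = Fin n → Fin k × Fin k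

rowSize : {n k : ℕ} → Partition n k → Fin k → ℕ
rowSize P i = count (λ v → ⌊ proj₁ (P v) ≟ i ⌋)

colSize : {n k : ℕ} → Partition n k → Fin k → ℕ
colSize P j = count (λ v → ⌊ proj₂ (P v) ≟ j ⌋)

-- |B_k(P,G)| = |⋃_{i≠j} E(V_{i*}, V_{*j})|: an edge ab lies in E(V_{i*},V_{*j})
-- exactly for i = row of a, j = column of b, so it is bad iff these differ.
badCount : {n k : ℕ} → Digraph n → Partition n k → ℕ
badCount G P = sumFin (λ a → count (λ b →
  adj G a b ∧ not ⌊ proj₁ (P a) ≟ proj₂ (P b) ⌋))

IsPartition : {n k : ℕ} → Digraph n → Partition n k → ℚ → ℚ → Set
IsPartition {n} {k} G P τ γ =
  (toℚ (badCount G P) ≤ γ * (toℚ n * toℚ n)) ×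
  ((i : Fin k) → (τ * toℚ n ≤ toℚ (rowSize P i)) × (τ * toℚ n ≤ toℚ (colSize P i)))

-- Every out-neighbour of a vertex of V_{i*} lies in V_{*i} unless the edge is bad,
-- so d-regularity gives |V_{i*}| (d − |V_{*i}|) ≤ |B| ≤ γ n².  As |V_{i*}| ≥ τ n, the
-- deficit d − |V_{*i}| is at most γ n / τ ≤ ε n / 2 once γ ≤ τ ε / 2.  Reversing every
-- edge and exchanging the two coordinates of the partition yields the bound for V_{i*}.
module Submission where

open import Defs
open import Data.Nat using (ℕ)
open import Data.Fin using (Fin)
open import Data.Product using (Σ; _×_; _,_; proj₁; proj₂)

module Counting where
  open import Data.Nat using (zero; suc; _+_; _*_; _∸_; _≤_; z≤n; s≤s)
  open import Data.Nat.Properties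
    using (≤-reflexive; ≤-trans; +-mono-≤; +-monoʳ-≤; +-suc; n≤1+n; m≤n+m; m≤n⇒m≤1+n;
           m≤n+o⇒m∸n≤o; +-0-commutativeMonoid)
  open import Data.Fin using (zero; suc)
  open import Data.Fin.Properties using (_≟_)
  open import Data.Bool using (Bool; true; false; T; _∧_; _∨_; not; if_then_else_)
  open import Data.Empty using (⊥-elim)
  open import Data.Unit using (tt)
  open import Data.Product using (swap)
  open import Function using (_∘_)
  open import Relation.Nullary.Decidable using (⌊_⌋; yes; no; toWitness)
  open import Relation.Binary.PropositionalEquality
  open import Algebra.Properties.CommutativeMonoid.Sum +-0-commutativeMonoid
    using (sum; sum-cong-≗; ∑-comm)

  sumFin≡sum : ∀ {n} (f : Fin n → ℕ) → sumFin f ≡ sum f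
  sumFin≡sum {zero}  f = refl
  sumFin≡sum {suc n} f = cong (f zero +_) (sumFin≡sum (f ∘ suc))

  count≡sum : ∀ {n} (p : Fin n → Bool) → count p ≡ sum (λ v → if p v then 1 else 0)
  count≡sum {zero}  p = refl
  count≡sum {suc n} p with p zero
  ... | true  = cong suc (count≡sum (p ∘ suc))
  ... | false = count≡sum (p ∘ suc)

  sumFin-count-comm : ∀ {m n} (R : Fin m → Fin n → Bool) →
    sumFin (λ a → count (λ b → R a b)) ≡ sumFin (λ b → count (λ a → R a b))
  sumFin-count-comm R = begin
    sumFin (λ a → count (R a))                             ≡⟨ sumFin≡sum (λ a → count (R a)) ⟩
    sum (λ a → count (R a))                                ≡⟨ sum-cong-≗ (count≡sum ∘ R) ⟩
    sum (λ a → sum (λ b → if R a b then 1 else 0))         ≡⟨ ∑-comm (λ a b → if R a b then 1 else 0) ⟩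
    sum (λ b → sum (λ a → if R a b then 1 else 0))         ≡⟨ sum-cong-≗ (λ b → count≡sum (λ a → R a b)) ⟨
    sum (λ b → count (λ a → R a b))                        ≡⟨ sumFin≡sum (λ b → count (λ a → R a b)) ⟨
    sumFin (λ b → count (λ a → R a b))                     ∎
    where open ≡-Reasoning

  sumFin-cong : ∀ {n} {f g : Fin n → ℕ} → (∀ v → f v ≡ g v) → sumFin f ≡ sumFin g
  sumFin-cong {zero}  f≗g = refl
  sumFin-cong {suc n} f≗g = cong₂ _+_ (f≗g zero) (sumFin-cong (f≗g ∘ suc))

  count-cong : ∀ {n} {p q : Fin n → Bool} → (∀ v → p v ≡ q v) → count p ≡ count q
  count-cong {zero}          p≗q = refl
  count-cong {suc n} {p} {q} p≗q with p zero | q zero | p≗q zero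
  ... | true  | true  | _ = cong suc (count-cong (p≗q ∘ suc))
  ... | false | false | _ = count-cong (p≗q ∘ suc)

  count-mono : ∀ {n} {p q : Fin n → Bool} → (∀ v → T (p v) → T (q v)) → count p ≤ count q
  count-mono {zero}          p⇒q = z≤n
  count-mono {suc n} {p} {q} p⇒q with p zero | q zero | p⇒q zero
  ... | true  | true  | _   = s≤s (count-mono (p⇒q ∘ suc))
  ... | true  | false | p⇒⊥ = ⊥-elim (p⇒⊥ tt)
  ... | false | true  | _   = m≤n⇒m≤1+n (count-mono (p⇒q ∘ suc))
  ... | false | false | _   = count-mono (p⇒q ∘ suc)

  count-∨ : ∀ {n} (p q : Fin n → Bool) → count (λ v → p v ∨ q v) ≤ count p + count q
  count-∨ {zero}  p q = z≤n
  count-∨ {suc n} p q with p zero | q zero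
  ... | true  | true  = s≤s (≤-trans (count-∨ (p ∘ suc) (q ∘ suc))
                                      (+-monoʳ-≤ (count (p ∘ suc)) (n≤1+n (count (q ∘ suc)))))
  ... | true  | false = s≤s (count-∨ (p ∘ suc) (q ∘ suc))
  ... | false | true  = ≤-trans (s≤s (count-∨ (p ∘ suc) (q ∘ suc)))
                                (≤-reflexive (sym (+-suc (count (p ∘ suc)) (count (q ∘ suc)))))
  ... | false | false = count-∨ (p ∘ suc) (q ∘ suc)

  count*≤sumFin : ∀ {n} (p : Fin n → Bool) (f : Fin n → ℕ) c →
    (∀ v → T (p v) → c ≤ f v) → count p * c ≤ sumFin f
  count*≤sumFin {zero}  p f c c≤f = z≤n
  count*≤sumFin {suc n} p f c c≤f with p zero | c≤f zero
  ... | true  | c≤f₀ = +-mono-≤ (c≤f₀ tt) (count*≤sumFin (p ∘ suc) (f ∘ suc) c (c≤f ∘ suc))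
  ... | false | _    = ≤-trans (count*≤sumFin (p ∘ suc) (f ∘ suc) c (c≤f ∘ suc))
                               (m≤n+m (sumFin (f ∘ suc)) (f zero))

  ⌊≟⌋-sym : ∀ {k} (x y : Fin k) → ⌊ x ≟ y ⌋ ≡ ⌊ y ≟ x ⌋
  ⌊≟⌋-sym x y with x ≟ y | y ≟ x
  ... | yes _   | yes _   = refl
  ... | no  _   | no  _   = refl
  ... | yes x≡y | no  y≢x = ⊥-elim (y≢x (sym x≡y))
  ... | no  x≢y | yes y≡x = ⊥-elim (x≢y (sym y≡x))

  transpose : ∀ {n} → Digraph n → Digraph n
  transpose G = record { adj = λ a b → adj G b a ; noLoop = noLoop G }

  transposeᴾ : ∀ {n k} → Partition n k → Partition n k
  transposeᴾ P = swap ∘ P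

  Regular-transpose : ∀ {n d} (G : Digraph n) → Regular G d → Regular (transpose G) d
  Regular-transpose G reg = swap ∘ reg

  badCount-transpose : ∀ {n k} (G : Digraph n) (P : Partition n k) →
    badCount (transpose G) (transposeᴾ P) ≡ badCount G P
  badCount-transpose {n} {k} G P = begin
    sumFin (λ a → count (λ b → adj G b a ∧ not ⌊ col a ≟ row b ⌋))
      ≡⟨ sumFin-count-comm (λ a b → adj G b a ∧ not ⌊ col a ≟ row b ⌋) ⟩
    sumFin (λ a → count (λ b → adj G a b ∧ not ⌊ col b ≟ row a ⌋))
      ≡⟨ sumFin-cong (λ a → count-cong (λ b →
           cong (λ x → adj G a b ∧ not x) (⌊≟⌋-sym (col b) (row a)))) ⟩
    badCount G P ∎
    where
    open ≡-Reasoning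
    row col : Fin n → Fin k
    row = proj₁ ∘ P
    col = proj₂ ∘ P

  module _ {n k : ℕ} (G : Digraph n) (P : Partition n k) where
    private
      row col : Fin n → Fin k
      row = proj₁ ∘ P
      col = proj₂ ∘ P

      bad : Fin n → Fin n → Bool
      bad a b = adj G a b ∧ not ⌊ row a ≟ col b ⌋

    outdeg≤colSize+badOutdeg : ∀ a → outdeg G a ≤ colSize P (row a) + count (bad a)
    outdeg≤colSize+badOutdeg a =
      ≤-trans (count-mono in-column-or-bad) (count-∨ (λ b → ⌊ col b ≟ row a ⌋) (bad a))
      where
      in-column-or-bad : ∀ b → T (adj G a b) → T (⌊ col b ≟ row a ⌋ ∨ bad a b)
      in-column-or-bad b ab with adj G a b | col b ≟ row a | row a ≟ col b
      ... | true | yes _ | _         = tt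
      ... | true | no  _ | no  _     = tt
      ... | true | no  c≢r | yes r≡c = c≢r (sym r≡c)

    rowSize*colDeficit≤badCount : ∀ {d} → Regular G d →
      ∀ i → rowSize P i * (d ∸ colSize P i) ≤ badCount G P
    rowSize*colDeficit≤badCount {d} reg i =
      count*≤sumFin (λ a → ⌊ row a ≟ i ⌋) (λ a → count (bad a)) (d ∸ colSize P i) deficit≤badOutdeg
      where
      deficit≤badOutdeg : ∀ a → T ⌊ row a ≟ i ⌋ → d ∸ colSize P i ≤ count (bad a)
      deficit≤badOutdeg a a∈Vᵢ with toWitness {a? = row a ≟ i} a∈Vᵢ
      ... | refl = m≤n+o⇒m∸n≤o d (colSize P i)
                     (subst (_≤ colSize P i + count (bad a)) (proj₁ (reg a))
                            (outdeg≤colSize+badOutdeg a))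

  colSize*rowDeficit≤badCount : ∀ {n k d} (G : Digraph n) (P : Partition n k) → Regular G d →
    ∀ i → colSize P i * (d ∸ rowSize P i) ≤ badCount G P
  colSize*rowDeficit≤badCount {d = d} G P reg i =
    subst (colSize P i * (d ∸ rowSize P i) ≤_) (badCount-transpose G P)
      (rowSize*colDeficit≤badCount (transpose G) (transposeᴾ P) (Regular-transpose G reg) i)

module Rational where
  import Data.Nat as ℕ
  import Data.Nat.Properties as ℕ
  import Data.Integer as ℤ
  import Data.Integer.Properties as ℤ
  open import Data.Integer using (+_)
  open import Data.Rational
  open import Data.Rational.Properties
  open import Data.Rational.Solver using (module +-*-Solver)
  open import Data.Nat.Coprimality using (1-coprimeTo) renaming (sym to coprime-sym)
  open import Relation.Binary.PropositionalEquality
  open +-*-Solver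

  toℚ≡mkℚ : ∀ m → toℚ m ≡ mkℚ (+ m) 0 (coprime-sym (1-coprimeTo m))
  toℚ≡mkℚ m = normalize-coprime (coprime-sym (1-coprimeTo m))

  toℚ-+ : ∀ m n → toℚ (m ℕ.+ n) ≡ toℚ m + toℚ n
  toℚ-+ m n = begin
    (+ m ℤ.+ + n) / 1
      ≡⟨ cong₂ (λ x y → (x ℤ.+ y) / 1) (ℤ.*-identityʳ (+ m)) (ℤ.*-identityʳ (+ n)) ⟨
    (+ m ℤ.* + 1 ℤ.+ + n ℤ.* + 1) / 1
      ≡⟨ cong₂ _+_ (toℚ≡mkℚ m) (toℚ≡mkℚ n) ⟨
    toℚ m + toℚ n ∎
    where open ≡-Reasoning

  toℚ-* : ∀ m n → toℚ (m ℕ.* n) ≡ toℚ m * toℚ n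
  toℚ-* m n = begin
    + (m ℕ.* n) / 1      ≡⟨ cong (_/ 1) (ℤ.pos-* m n) ⟩
    (+ m ℤ.* + n) / 1    ≡⟨ cong₂ _*_ (toℚ≡mkℚ m) (toℚ≡mkℚ n) ⟨
    toℚ m * toℚ n        ∎
    where open ≡-Reasoning

  toℚ-mono-≤ : ∀ {m n} → m ℕ.≤ n → toℚ m ≤ toℚ n
  toℚ-mono-≤ {m} {n} m≤n rewrite toℚ≡mkℚ m | toℚ≡mkℚ n =
    *≤* (ℤ.*-monoʳ-≤-nonNeg (+ 1) (ℤ.+≤+ m≤n))

  toℚ-pos : ∀ {n} → 1 ℕ.≤ n → 0ℚ < toℚ n
  toℚ-pos {n} 1≤n = <-≤-trans (positive⁻¹ 1ℚ) (toℚ-mono-≤ {1} {n} 1≤n)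

  toℚ-nonNeg : ∀ n → 0ℚ ≤ toℚ n
  toℚ-nonNeg n = toℚ-mono-≤ {0} {n} ℕ.z≤n

  pos*pos : ∀ {p q} → 0ℚ < p → 0ℚ < q → 0ℚ < p * q
  pos*pos {p} {q} 0<p 0<q =
    positive⁻¹ (p * q) {{pos*pos⇒pos p {{positive 0<p}} q {{positive 0<q}}}}

  ≤+⇒-≤ : ∀ {p q r} → p ≤ q + r → p - r ≤ q
  ≤+⇒-≤ {p} {q} {r} p≤q+r = begin
    p - r      ≤⟨ +-monoˡ-≤ (- r) p≤q+r ⟩
    q + r - r  ≡⟨ solve 2 (λ q r → q :+ r :- r := q) refl q r ⟩
    q          ∎
    where open ≤-Reasoning

  deficit-bound : ∀ {τ ε γ N R E} → 0ℚ < τ → 0ℚ < N → 0ℚ ≤ E → γ ≤ τ * ε * ½ →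
    τ * N ≤ R → R * E ≤ γ * (N * N) → E ≤ ε * N * ½
  deficit-bound {τ} {ε} {γ} {N} {R} {E} 0<τ 0<N 0≤E γ≤ τN≤R RE≤γN² =
    *-cancelˡ-≤-pos (τ * N) {{positive (pos*pos 0<τ 0<N)}} (begin
      (τ * N) * E              ≤⟨ *-monoʳ-≤-nonNeg E {{nonNegative 0≤E}} τN≤R ⟩
      R * E                    ≤⟨ RE≤γN² ⟩
      γ * (N * N)              ≤⟨ *-monoʳ-≤-nonNeg (N * N) {{nonNegative (<⇒≤ (pos*pos 0<N 0<N))}} γ≤ ⟩
      τ * ε * ½ * (N * N)
        ≡⟨ solve 3 (λ t e n → t :* e :* con ½ :* (n :* n) := (t :* n) :* (e :* n :* con ½)) refl τ ε N ⟩
      (τ * N) * (ε * N * ½)    ∎)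
    where open ≤-Reasoning

  size-lower-bound : ∀ {τ ε γ n B} d r c → 1 ℕ.≤ n → 0ℚ < τ → γ ≤ τ * ε * ½ →
    τ * toℚ n ≤ toℚ r → toℚ B ≤ γ * (toℚ n * toℚ n) → r ℕ.* (d ℕ.∸ c) ℕ.≤ B →
    toℚ d - ε * toℚ n * ½ ≤ toℚ c
  size-lower-bound {τ} {ε} {γ} {n} {B} d r c 1≤n 0<τ γ≤ τn≤r B≤γn² r*deficit≤B =
    ≤+⇒-≤ (begin
      toℚ d                        ≤⟨ toℚ-mono-≤ (ℕ.m≤n+m∸n d c) ⟩
      toℚ (c ℕ.+ (d ℕ.∸ c))        ≡⟨ toℚ-+ c (d ℕ.∸ c) ⟩
      toℚ c + toℚ (d ℕ.∸ c)        ≤⟨ +-monoʳ-≤ (toℚ c) deficit≤ ⟩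
      toℚ c + ε * toℚ n * ½        ∎)
    where
    open ≤-Reasoning
    r*deficit≤γn² : toℚ r * toℚ (d ℕ.∸ c) ≤ γ * (toℚ n * toℚ n)
    r*deficit≤γn² = begin
      toℚ r * toℚ (d ℕ.∸ c)   ≡⟨ toℚ-* r (d ℕ.∸ c) ⟨
      toℚ (r ℕ.* (d ℕ.∸ c))   ≤⟨ toℚ-mono-≤ r*deficit≤B ⟩
      toℚ B                   ≤⟨ B≤γn² ⟩
      γ * (toℚ n * toℚ n)     ∎
    deficit≤ : toℚ (d ℕ.∸ c) ≤ ε * toℚ n * ½
    deficit≤ = deficit-bound 0<τ (toℚ-pos 1≤n) (toℚ-nonNeg (d ℕ.∸ c)) γ≤ τn≤r r*deficit≤γn²

  weaken-size-bound : ∀ α ε N D S → (α + ε) * N ≤ D → D - ε * N * ½ ≤ S → (α + ε * ½) * N ≤ S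
  weaken-size-bound α ε N D S αεN≤D D-εN/2≤S = begin
    (α + ε * ½) * N
      ≡⟨ solve 3 (λ a e n → (a :+ e :* con ½) :* n := (a :+ e) :* n :- e :* n :* con ½) refl α ε N ⟩
    (α + ε) * N - ε * N * ½      ≤⟨ +-monoˡ-≤ (- (ε * N * ½)) αεN≤D ⟩
    D - ε * N * ½                ≤⟨ D-εN/2≤S ⟩
    S                            ∎
    where open ≤-Reasoning

open import Data.Rational using (ℚ; _≤_; _<_; _*_; _+_; _-_; 0ℚ; ½; 1ℚ)
open import Data.Rational.Properties using (positive⁻¹)
open Counting using (rowSize*colDeficit≤badCount; colSize*rowDeficit≤badCount)
open Rational using (pos*pos; size-lower-bound; weaken-size-bound)

proposition3p8 :
    Σ ℚ λ α₀ → (0ℚ < α₀) ×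
    ((α : ℚ) → 0ℚ < α → α ≤ α₀ →
     Σ ℚ λ ε₀ → (0ℚ < ε₀) ×
     ((ε : ℚ) → 0ℚ < ε → ε ≤ ε₀ →
      Σ ℚ λ τ₀ → (0ℚ < τ₀) ×
      ((τ : ℚ) → 0ℚ < τ → τ ≤ τ₀ →
       Σ ℚ λ γ₀ → (0ℚ < γ₀) ×
       ((γ : ℚ) → 0ℚ < γ → γ ≤ γ₀ →
        Σ ℕ λ n₀ →
        ((n k d : ℕ) → n₀ Data.Nat.≤ n →
         (G : Digraph n) → Regular G d →
         (α + ε) * toℚ n ≤ toℚ d →
         (P : Partition n k) → IsPartition G P τ γ →
         ((i : Fin k) →
            (toℚ d - ε * toℚ n * ½ ≤ toℚ (rowSize P i)) ×
            (toℚ d - ε * toℚ n * ½ ≤ toℚ (colSize P i)))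
         × IsPartition G P (α + ε * ½) γ)))))
proposition3p8 =
  1ℚ , positive⁻¹ 1ℚ , λ α _ _ →
  1ℚ , positive⁻¹ 1ℚ , λ ε 0<ε _ →
  1ℚ , positive⁻¹ 1ℚ , λ τ 0<τ _ →
  τ * ε * ½ , pos*pos (pos*pos 0<τ 0<ε) (positive⁻¹ ½) , λ γ _ γ≤ →
  1 , λ n k d 1≤n G reg αεn≤d P (bad≤γn² , τn≤sizes) →
    let row≥ : ∀ i → toℚ d - ε * toℚ n * ½ ≤ toℚ (rowSize P i)
        row≥ i = size-lower-bound d (colSize P i) (rowSize P i) 1≤n 0<τ γ≤
                   (proj₂ (τn≤sizes i)) bad≤γn² (colSize*rowDeficit≤badCount G P reg i)
        col≥ : ∀ i → toℚ d - ε * toℚ n * ½ ≤ toℚ (colSize P i)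
        col≥ i = size-lower-bound d (rowSize P i) (colSize P i) 1≤n 0<τ γ≤
                   (proj₁ (τn≤sizes i)) bad≤γn² (rowSize*colDeficit≤badCount G P reg i)
        weaken : ∀ S → toℚ d - ε * toℚ n * ½ ≤ S → (α + ε * ½) * toℚ n ≤ S
        weaken S = weaken-size-bound α ε (toℚ n) (toℚ d) S αεn≤d
    in (λ i → row≥ i , col≥ i) ,
       bad≤γn² , (λ i → weaken _ (row≥ i) , weaken _ (col≥ i))
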